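{- Let $Q_n$ be the induced subposet of $\Pi^2_n$ consisting of the triples $(\pi,\rho,\lambda)$ such that $\pi$ is an interval partition (every block of $\pi$ is a set of consecutive integers). Then $Q_n$ is isomorphic to the face poset of the permutahedron, i.e. to the poset of ordered set partitions $(C_1,\dots,C_k)$ (sequences of pairwise disjoint nonempty sets with union $\{1,\dots,n\}$) in which $(C_1,\dots,C_{l-1},C_l\cup C_{l+1},C_{l+2},\dots,C_k)$ is covered by $(C_1,\dots,C_k)$ (and these are all the cover relations).
   Context: $\Pi_n$: set partitions of $\{1,\dots,n\}$; $NC_n$: noncrossing set partitions; both ordered so that $\pi\leq\tau$ iff $\tau$ refines $\pi$. $\Pi^2_n$ is the set of triples $(\pi,\rho,\lambda)$ with $\pi\in NC_n$, $\rho\in\Pi_n$, $\lambda$ a bijection from blocks of $\pi$ to blocks of $\rho$ with $|\lambda(B)|=|B|$, ordered by $(\pi,\rho,\lambda)\geq(\pi',\rho',\lambda')$ iff $\pi$ refines $\pi'$, $\rho$ refines $\rho'$, and $\lambda'(\biguplus_iB_i)=\biguplus_i\lambda(B_i)$ whenever $\biguplus_iB_i\in\pi'$ with $B_i\in\pi$. The faces of the permutahedron are indexed by ordered set partitions of $\{1,\dots,n\}$, with the order described in the claim. -}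

module Defs where

open import Data.Nat using (ℕ)
open import Data.Fin using (Fin; _<_; _≤_)
open import Data.Fin.Subset using (Subset; Nonempty; _∪_; _⊆_; ∣_∣) renaming (_∈_ to _∈ₛ_)
open import Data.List using (List; []; _∷_; length; lookup; map)
open import Data.List.Membership.Propositional using (_∈_)
open import Data.Product using (Σ; ∃; _×_; _,_; proj₁; proj₂)
open import Data.Empty using (⊥)
open import Relation.Nullary using (¬_)
open import Relation.Binary.PropositionalEquality using (_≡_; _≢_)
open import Relation.Binary.Construct.Closure.ReflexiveTransitive using (Star)

-- The ground set {1,…,n} is modelled by Fin n (element i : Fin n stands for i+1),
-- with its natural order.

-- A set partition given as a list of blocks (the order of the list is irrelevant
-- for set partitions, relevant for ordered set partitions): every block is
-- nonempty and every element lies in exactly one block (position of the list).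
record IsSetPartition {n : ℕ} (bs : List (Subset n)) : Set where
  field
    nonempty : ∀ (k : Fin (length bs)) → Nonempty (lookup bs k)
    cover    : ∀ (i : Fin n) → Σ (Fin (length bs)) λ k → i ∈ₛ lookup bs k
    unique   : ∀ (i : Fin n) (k k' : Fin (length bs)) →
               i ∈ₛ lookup bs k → i ∈ₛ lookup bs k' → k ≡ k'

IsNoncrossing : {n : ℕ} → List (Subset n) → Set
IsNoncrossing {n} bs =
  ∀ (k k' : Fin (length bs)) → k ≢ k' →
  ∀ (a b c d : Fin n) → a < b → b < c → c < d →
  a ∈ₛ lookup bs k → c ∈ₛ lookup bs k →
  b ∈ₛ lookup bs k' → d ∈ₛ lookup bs k' → ⊥

IsInterval : {n : ℕ} → List (Subset n) → Set
IsInterval {n} bs =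
  ∀ (k : Fin (length bs)) (a b c : Fin n) →
  a ∈ₛ lookup bs k → c ∈ₛ lookup bs k → a ≤ b → b ≤ c → b ∈ₛ lookup bs k

-- An element (π, ρ, λ) of Π²_n is encoded as the list of pairs (B, λ(B)), B ∈ π.
-- Since both π and ρ are set partitions listed position-wise, λ is a bijection
-- from blocks of π to blocks of ρ.
record IsPi2 {n : ℕ} (xs : List (Subset n × Subset n)) : Set where
  field
    π-partition : IsSetPartition (map proj₁ xs)
    π-noncrossing : IsNoncrossing (map proj₁ xs)
    ρ-partition : IsSetPartition (map proj₂ xs)
    sizes : ∀ {B D : Subset n} → (B , D) ∈ xs → ∣ B ∣ ≡ ∣ D ∣

Pi2 : ℕ → Set
Pi2 n = Σ (List (Subset n × Subset n)) IsPi2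

record _≤Π²_ {n : ℕ} (x y : Pi2 n) : Set where
  field
    π-refines : ∀ {B D} → (B , D) ∈ proj₁ y →
                ∃ λ B' → ∃ λ D' → (B' , D') ∈ proj₁ x × B ⊆ B'
    ρ-refines : ∀ {B D} → (B , D) ∈ proj₁ y →
                ∃ λ B' → ∃ λ D' → (B' , D') ∈ proj₁ x × D ⊆ D'
    λ-compat  : ∀ {B' D'} → (B' , D') ∈ proj₁ x → ∀ (j : Fin n) →
                (j ∈ₛ D' → ∃ λ B → ∃ λ D → (B , D) ∈ proj₁ y × B ⊆ B' × j ∈ₛ D)
                × ((∃ λ B → ∃ λ D → (B , D) ∈ proj₁ y × B ⊆ B' × j ∈ₛ D) → j ∈ₛ D')

Q : ℕ → Set
Q n = Σ (Pi2 n) λ x → IsInterval (map proj₁ (proj₁ x))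

_≤Q_ : {n : ℕ} → Q n → Q n → Set
x ≤Q y = proj₁ x ≤Π² proj₁ y

OSP : ℕ → Set
OSP n = Σ (List (Subset n)) IsSetPartition

data Merge {n : ℕ} : List (Subset n) → List (Subset n) → Set where
  here  : ∀ (C C' : Subset n) (cs : List (Subset n)) →
          Merge (C ∷ C' ∷ cs) ((C ∪ C') ∷ cs)
  there : ∀ (C : Subset n) {cs ds : List (Subset n)} →
          Merge cs ds → Merge (C ∷ cs) (C ∷ ds)

_≤OSP_ : {n : ℕ} → OSP n → OSP n → Set
x ≤OSP y = Star Merge (proj₁ y) (proj₁ x)

-- Every block of an element of Q_n is an interval, so listing the images λ(B) in the order
-- of the positions of the blocks B gives an ordered set partition (C₁, …, C_k); conversely
-- (C₁, …, C_k) is recovered by laying out C₁, …, C_k on consecutive intervals of lengths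
-- ∣C₁∣, …, ∣C_k∣.  Between two such layouts the order of Π²_n says that every coarse interval is
-- a union of consecutive fine intervals whose images it unites: comparing first blocks, either
-- they coincide and one recurses on the rest, or the first fine block is shorter and merging it
-- with the next one keeps the relation.  This turns the relation into a sequence of merges of
-- consecutive blocks, and each such merge is in turn a relation of Π²_n.
module Submission where

open import Defs
open import Data.Nat using (ℕ; zero; suc; _+_; _∸_; z≤n; s≤s; _≤_; _<_; _<?_)
open import Data.Nat.Properties
open import Data.Fin using (Fin; zero; suc; toℕ; fromℕ<)
open import Data.Fin.Properties using (toℕ<n; toℕ-fromℕ<) renaming (suc-injective to Fin-suc-injective)
open import Data.Fin.Subset
  using (Subset; Nonempty; _∪_; _⊆_; ∣_∣; inside; outside; ⋃; ⊤)
  renaming (_∈_ to _∈ₛ_; _∉_ to _∉ₛ_)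
open import Data.Fin.Subset.Properties
  using (_∈?_; x∈p∪q⁻; x∈p∪q⁺; ⊆-antisym; p⊆q⇒∣p∣≤∣q∣; ∣⁅x⁆∣≡1; x∈⁅y⁆⇒x≡y;
         ∉⊥; ∣⊥∣≡0; ∈⊤; ⊆⊤; ∣⊤∣≡n; ∣p∣≡n⇒p≡⊤)
open import Data.Vec using ([]; _∷_; here; there)
open import Data.List using (List; []; _∷_; _++_; length; lookup; map)
open import Data.Nat.ListAction using (sum)
open import Data.List.Membership.Propositional using (_∈_; find; lose)
open import Data.List.Relation.Unary.Any using (Any; here; there; index)
open import Data.List.Relation.Unary.Any.Properties using (lookup-index; ¬Any[])
import Data.List.Relation.Unary.Any.Properties as Any
import Data.List.Relation.Unary.All.Properties as All
import Data.List.Relation.Unary.AllPairs.Properties as AllPairs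
open import Data.List.Membership.Propositional.Properties using (∈-lookup; ∈-∃++)
open import Data.List.Relation.Unary.All using (All; []; _∷_)
import Data.List.Relation.Unary.All as All
open import Data.List.Relation.Unary.AllPairs using (AllPairs; []; _∷_)
import Data.List.Relation.Unary.AllPairs as AllPairs
open import Data.List.Relation.Binary.Permutation.Propositional
  using (_↭_; refl; prep; ↭-sym; ↭-trans; ↭⇒↭ₛ)
open import Data.List.Relation.Binary.Permutation.Propositional.Properties
  using (∈-resp-↭; Any-resp-↭; All-resp-↭; shift; ↭-length)
import Data.List.Relation.Binary.Permutation.Setoid.Properties as Permutationₛ
open import Data.Product using (Σ; ∃; _×_; _,_; proj₁; proj₂)
open import Data.Sum using (inj₁; inj₂)
open import Data.Empty using (⊥-elim) renaming (⊥ to Empty)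
open import Function using (_∘_; id)
open import Relation.Nullary using (yes; no)
open import Relation.Binary.PropositionalEquality
open import Relation.Binary.Construct.Closure.ReflexiveTransitive using (Star; ε; _◅_; gmap)

private
  variable
    n : ℕ

Disjoint : Subset n → Subset n → Set
Disjoint p q = ∀ {i} → i ∈ₛ p → i ∈ₛ q → Empty

Disjoint-sym : {p q : Subset n} → Disjoint p q → Disjoint q p
Disjoint-sym d i∈q i∈p = d i∈p i∈q

Disjoint-∪ : {p q r : Subset n} → Disjoint p r → Disjoint q r → Disjoint (p ∪ q) r
Disjoint-∪ {p = p} {q} dp dq i∈p∪q i∈r with x∈p∪q⁻ p q i∈p∪q
... | inj₁ i∈p = dp i∈p i∈r
... | inj₂ i∈q = dq i∈q i∈r

∣p∪q∣≡∣p∣+∣q∣ : (p q : Subset n) → Disjoint p q → ∣ p ∪ q ∣ ≡ ∣ p ∣ + ∣ q ∣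
∣p∪q∣≡∣p∣+∣q∣ []            []            d = refl
∣p∪q∣≡∣p∣+∣q∣ (inside ∷ p)  (inside ∷ q)  d = ⊥-elim (d here here)
∣p∪q∣≡∣p∣+∣q∣ (inside ∷ p)  (outside ∷ q) d =
  cong suc (∣p∪q∣≡∣p∣+∣q∣ p q (λ i∈p i∈q → d (there i∈p) (there i∈q)))
∣p∪q∣≡∣p∣+∣q∣ (outside ∷ p) (inside ∷ q)  d =
  trans (cong suc (∣p∪q∣≡∣p∣+∣q∣ p q (λ i∈p i∈q → d (there i∈p) (there i∈q))))
        (sym (+-suc ∣ p ∣ ∣ q ∣))
∣p∪q∣≡∣p∣+∣q∣ (outside ∷ p) (outside ∷ q) d =
  ∣p∪q∣≡∣p∣+∣q∣ p q (λ i∈p i∈q → d (there i∈p) (there i∈q))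

Nonempty⇒∣p∣≥1 : ∀ {n} {p : Subset n} → Nonempty p → 1 ≤ ∣ p ∣
Nonempty⇒∣p∣≥1 (i , i∈p) =
  subst (_≤ _) (∣⁅x⁆∣≡1 i) (p⊆q⇒∣p∣≤∣q∣ (λ j∈⁅i⁆ → subst (_∈ₛ _) (sym (x∈⁅y⁆⇒x≡y i j∈⁅i⁆)) i∈p))

interval : ℕ → ℕ → Subset n
interval {zero}  _       _       = []
interval {suc n} zero    zero    = outside ∷ interval zero zero
interval {suc n} zero    (suc a) = inside ∷ interval zero a
interval {suc n} (suc s) a       = outside ∷ interval s a

∈-interval⁻ : ∀ s a (i : Fin n) → i ∈ₛ interval s a → s ≤ toℕ i × toℕ i < s + a
∈-interval⁻ zero    zero    (suc i) (there i∈I) = ⊥-elim (n≮0 (proj₂ (∈-interval⁻ zero zero i i∈I)))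
∈-interval⁻ zero    (suc a) zero    here        = z≤n , s≤s z≤n
∈-interval⁻ zero    (suc a) (suc i) (there i∈I) = z≤n , s≤s (proj₂ (∈-interval⁻ zero a i i∈I))
∈-interval⁻ (suc s) a       (suc i) (there i∈I) =
  let s≤i , i<s+a = ∈-interval⁻ s a i i∈I in s≤s s≤i , s≤s i<s+a

∈-interval⁺ : ∀ s a (i : Fin n) → s ≤ toℕ i → toℕ i < s + a → i ∈ₛ interval s a
∈-interval⁺ zero    (suc a) zero    _         _           = here
∈-interval⁺ zero    (suc a) (suc i) _         (s≤s i<a)   = there (∈-interval⁺ zero a i z≤n i<a)
∈-interval⁺ (suc s) a       (suc i) (s≤s s≤i) (s≤s i<s+a) = there (∈-interval⁺ s a i s≤i i<s+a)

∣interval∣ : ∀ s a → s + a ≤ n → ∣ interval {n} s a ∣ ≡ a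
∣interval∣ {zero}  zero    zero    _         = refl
∣interval∣ {suc n} zero    zero    _         = ∣interval∣ {n} zero zero z≤n
∣interval∣ {suc n} zero    (suc a) (s≤s a≤n) = cong suc (∣interval∣ zero a a≤n)
∣interval∣ {suc n} (suc s) a       (s≤s s+a≤n) = ∣interval∣ s a s+a≤n

interval-⊆ : ∀ {n s t a b} → s ≤ t → t + b ≤ s + a → interval {n} t b ⊆ interval s a
interval-⊆ {n} {s} {t} {a} {b} s≤t t+b≤s+a {i} i∈I =
  let t≤i , i<t+b = ∈-interval⁻ t b i i∈I
  in ∈-interval⁺ s a i (≤-trans s≤t t≤i) (<-≤-trans i<t+b t+b≤s+a)

interval-⊆ˡ : ∀ {n} s a b → interval {n} s a ⊆ interval s (a + b)
interval-⊆ˡ s a b = interval-⊆ ≤-refl (+-monoʳ-≤ s (m≤m+n a b))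

interval-⊆ʳ : ∀ {n} s a b → interval {n} (s + a) b ⊆ interval s (a + b)
interval-⊆ʳ s a b = interval-⊆ (m≤m+n s a) (≤-reflexive (+-assoc s a b))

start∈interval : ∀ {n s a} → 1 ≤ a → s + a ≤ n → Σ (Fin n) λ e → toℕ e ≡ s × e ∈ₛ interval s a
start∈interval {n} {s} {a} 1≤a s+a≤n = e , toℕ-fromℕ< s<n ,
  ∈-interval⁺ s a e (≤-reflexive (sym (toℕ-fromℕ< s<n)))
                    (subst (_< s + a) (sym (toℕ-fromℕ< s<n)) s<s+a)
  where
  s<s+a : s < s + a
  s<s+a = m<m+n s 1≤a
  s<n : s < n
  s<n = <-≤-trans s<s+a s+a≤n
  e : Fin n
  e = fromℕ< s<n

Convex : Subset n → Set
Convex {n} B = ∀ (i j k : Fin n) → i ∈ₛ B → k ∈ₛ B → toℕ i ≤ toℕ j → toℕ j ≤ toℕ k → j ∈ₛ B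

interval-convex : ∀ s a → Convex (interval {n} s a)
interval-convex s a i j k i∈I k∈I i≤j j≤k =
  ∈-interval⁺ s a j (≤-trans (proj₁ (∈-interval⁻ s a i i∈I)) i≤j)
                    (≤-<-trans j≤k (proj₂ (∈-interval⁻ s a k k∈I)))

module _ {B : Subset n} (convex : Convex B) {e : Fin n} (e∈B : e ∈ₛ B) where

  convex-⊇-interval : ∀ {s a} {t : Fin n} → t ∈ₛ B → toℕ e ≤ s → s + a ≤ suc (toℕ t) →
                      interval s a ⊆ B
  convex-⊇-interval {s} {a} {t} t∈B e≤s s+a≤t+1 {j} j∈I =
    let s≤j , j<s+a = ∈-interval⁻ s a j j∈I
    in convex e j t e∈B t∈B (≤-trans e≤s s≤j) (≤-pred (<-≤-trans j<s+a s+a≤t+1))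

  convex-below-gap : ∀ {u t : Fin n} → u ∉ₛ B → toℕ e ≤ toℕ u → t ∈ₛ B → toℕ t < toℕ u
  convex-below-gap {u} {t} u∉B e≤u t∈B with toℕ t <? toℕ u
  ... | yes t<u = t<u
  ... | no  t≮u = ⊥-elim (u∉B (convex e u t e∈B t∈B e≤u (≮⇒≥ t≮u)))

  convex-interval : ∀ {s} → toℕ e ≡ s → (∀ {i} → i ∈ₛ B → s ≤ toℕ i) →
                    s + ∣ B ∣ ≤ n × B ≡ interval s ∣ B ∣
  convex-interval {s} refl min = s+m≤n , ⊆-antisym B⊆I I⊆B
    where
    m : ℕ
    m = ∣ B ∣
    s+[n∸s]≡n : s + (n ∸ s) ≡ n
    s+[n∸s]≡n = m+[n∸m]≡n (<⇒≤ (toℕ<n e))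
    s+m≤n : s + m ≤ n
    s+m≤n = subst (s + m ≤_) s+[n∸s]≡n (+-monoʳ-≤ s (subst (m ≤_)
              (∣interval∣ s (n ∸ s) (≤-reflexive s+[n∸s]≡n))
              (p⊆q⇒∣p∣≤∣q∣ λ {t} t∈B →
                ∈-interval⁺ s (n ∸ s) t (min t∈B) (subst (toℕ t <_) (sym s+[n∸s]≡n) (toℕ<n t)))))
    B⊆I : B ⊆ interval s m
    B⊆I {t} t∈B = ∈-interval⁺ s m t (min t∈B) (≤-trans (≤-reflexive (sym s+k≡t+1)) (+-monoʳ-≤ s k≤m))
      where
      k : ℕ
      k = suc (toℕ t ∸ s)
      s+k≡t+1 : s + k ≡ suc (toℕ t)
      s+k≡t+1 = trans (+-suc s (toℕ t ∸ s)) (cong suc (m+[n∸m]≡n (min t∈B)))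
      k≤m : k ≤ m
      k≤m = subst (_≤ m) (∣interval∣ s k (subst (_≤ n) (sym s+k≡t+1) (toℕ<n t)))
              (p⊆q⇒∣p∣≤∣q∣ (convex-⊇-interval t∈B ≤-refl (≤-reflexive s+k≡t+1)))
    I⊆B : interval s m ⊆ B
    I⊆B {u} u∈I with u ∈? B
    ... | yes u∈B = u∈B
    ... | no  u∉B =
      ⊥-elim (<⇒≱ (proj₂ (∈-interval⁻ s m u u∈I)) (subst (s + m ≤_) s+k≡u (+-monoʳ-≤ s m≤k)))
      where
      s≤u : s ≤ toℕ u
      s≤u = proj₁ (∈-interval⁻ s m u u∈I)
      k : ℕ
      k = toℕ u ∸ s
      s+k≡u : s + k ≡ toℕ u
      s+k≡u = m+[n∸m]≡n s≤u
      m≤k : m ≤ k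
      m≤k = subst (m ≤_) (∣interval∣ s k (subst (_≤ n) (sym s+k≡u) (<⇒≤ (toℕ<n u))))
              (p⊆q⇒∣p∣≤∣q∣ λ {t} t∈B → ∈-interval⁺ s k t (min t∈B)
                (subst (toℕ t <_) (sym s+k≡u) (convex-below-gap u∉B s≤u t∈B)))

Pair : ℕ → Set
Pair n = Subset n × Subset n

BlocksDisjoint : List (Pair n) → Set
BlocksDisjoint = AllPairs (λ p q → Disjoint (proj₁ p) (proj₁ q))

BlocksNonempty : List (Pair n) → Set
BlocksNonempty = All (Nonempty ∘ proj₁)

same-block : {xs : List (Pair n)} → BlocksDisjoint xs → ∀ {p q i} → p ∈ xs → q ∈ xs →
             i ∈ₛ proj₁ p → i ∈ₛ proj₁ q → p ≡ q
same-block _            (here refl) (here refl) _   _   = refl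
same-block (d ∷ _)      (here refl) (there q∈) i∈p i∈q = ⊥-elim (All.lookup d q∈ i∈p i∈q)
same-block (d ∷ _)      (there p∈)  (here refl) i∈p i∈q = ⊥-elim (All.lookup d p∈ i∈q i∈p)
same-block (_ ∷ disj)   (there p∈)  (there q∈) i∈p i∈q = same-block disj p∈ q∈ i∈p i∈q

BlocksRefine : List (Pair n) → List (Pair n) → Set
BlocksRefine xs ys = ∀ {B D} → (B , D) ∈ ys → ∃ λ B' → ∃ λ D' → (B' , D') ∈ xs × B ⊆ B'

ImageBelow : List (Pair n) → Subset n → Fin n → Set
ImageBelow ys B' j = ∃ λ B → ∃ λ D → (B , D) ∈ ys × B ⊆ B' × j ∈ₛ D

ImagesCompatible : List (Pair n) → List (Pair n) → Set
ImagesCompatible {n} xs ys = ∀ {B' D'} → (B' , D') ∈ xs → ∀ (j : Fin n) →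
                             (j ∈ₛ D' → ImageBelow ys B' j) × (ImageBelow ys B' j → j ∈ₛ D')

-- _≤Π²_ on bare lists, without its field ρ-refines, which follows from the other two.
record _⊑_ (xs ys : List (Pair n)) : Set where
  constructor mk⊑
  field
    blocks-refine     : BlocksRefine xs ys
    images-compatible : ImagesCompatible xs ys
open _⊑_

≤Π²⇒⊑ : {x y : Pi2 n} → x ≤Π² y → proj₁ x ⊑ proj₁ y
≤Π²⇒⊑ x≤y = mk⊑ (_≤Π²_.π-refines x≤y) (_≤Π²_.λ-compat x≤y)

⊑⇒≤Π² : {x y : Pi2 n} → proj₁ x ⊑ proj₁ y → x ≤Π² y
⊑⇒≤Π² x⊑y = record
  { π-refines = blocks-refine x⊑y
  ; ρ-refines = ρ-refines
  ; λ-compat  = images-compatible x⊑y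
  }
  where
  ρ-refines : ∀ {B D} → (B , D) ∈ _ → ∃ λ B' → ∃ λ D' → (B' , D') ∈ _ × D ⊆ D'
  ρ-refines {B} {D} BD∈y =
    let B' , D' , B'D'∈x , B⊆B' = blocks-refine x⊑y BD∈y
    in B' , D' , B'D'∈x , λ {j} j∈D → proj₂ (images-compatible x⊑y B'D'∈x j) (B , D , BD∈y , B⊆B' , j∈D)

⊑-resp-↭ : {xs xs' ys ys' : List (Pair n)} → xs ↭ xs' → ys ↭ ys' → xs ⊑ ys → xs' ⊑ ys'
⊑-resp-↭ xs↭xs' ys↭ys' xs⊑ys = mk⊑ refine compatible
  where
  refine : BlocksRefine _ _
  refine BD∈ys' =
    let B' , D' , B'D'∈xs , B⊆B' = blocks-refine xs⊑ys (∈-resp-↭ (↭-sym ys↭ys') BD∈ys')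
    in B' , D' , ∈-resp-↭ xs↭xs' B'D'∈xs , B⊆B'
  transport : ∀ {ys ys' B' j} → ys ↭ ys' → ImageBelow ys B' j → ImageBelow ys' B' j
  transport ys↭ys' (B , D , BD∈ , B⊆B' , j∈D) = B , D , ∈-resp-↭ ys↭ys' BD∈ , B⊆B' , j∈D
  compatible : ImagesCompatible _ _
  compatible B'D'∈xs' j =
    let to , from = images-compatible xs⊑ys (∈-resp-↭ (↭-sym xs↭xs') B'D'∈xs') j
    in transport ys↭ys' ∘ to , from ∘ transport (↭-sym ys↭ys')

module _ {xs : List (Pair n)} (disjoint : BlocksDisjoint xs) where

  ⊑-refl : BlocksNonempty xs → xs ⊑ xs
  ⊑-refl nonempty = mk⊑ (λ {B} {D} BD∈ → B , D , BD∈ , id) compatible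
    where
    compatible : ImagesCompatible xs xs
    compatible {B'} {D'} B'D'∈ j =
        (λ j∈D' → B' , D' , B'D'∈ , id , j∈D')
      , λ (B , D , BD∈ , B⊆B' , j∈D) →
          let i , i∈B = All.lookup nonempty BD∈
          in subst (λ p → j ∈ₛ proj₂ p) (same-block disjoint BD∈ B'D'∈ i∈B (B⊆B' i∈B)) j∈D

  ⊑-trans : {ws ys : List (Pair n)} → BlocksNonempty ys → xs ⊑ ws → ws ⊑ ys → xs ⊑ ys
  ⊑-trans {ws} {ys} nonempty xs⊑ws ws⊑ys = mk⊑ refine compatible
    where
    refine : BlocksRefine xs ys
    refine BD∈ys =
      let B₁ , D₁ , B₁D₁∈ws , B⊆B₁ = blocks-refine ws⊑ys BD∈ys
          B₂ , D₂ , B₂D₂∈xs , B₁⊆B₂ = blocks-refine xs⊑ws B₁D₁∈ws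
      in B₂ , D₂ , B₂D₂∈xs , B₁⊆B₂ ∘ B⊆B₁
    compatible : ImagesCompatible xs ys
    compatible {B'} {D'} B'D'∈xs j = to , from
      where
      to : j ∈ₛ D' → ImageBelow ys B' j
      to j∈D' =
        let B₁ , D₁ , B₁D₁∈ws , B₁⊆B' , j∈D₁ = proj₁ (images-compatible xs⊑ws B'D'∈xs j) j∈D'
            B₀ , D₀ , B₀D₀∈ys , B₀⊆B₁ , j∈D₀ = proj₁ (images-compatible ws⊑ys B₁D₁∈ws j) j∈D₁
        in B₀ , D₀ , B₀D₀∈ys , B₁⊆B' ∘ B₀⊆B₁ , j∈D₀
      from : ImageBelow ys B' j → j ∈ₛ D'
      from (B₀ , D₀ , B₀D₀∈ys , B₀⊆B' , j∈D₀)
        with B₁ , D₁ , B₁D₁∈ws , B₀⊆B₁ ← blocks-refine ws⊑ys B₀D₀∈ys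
        with B₂ , D₂ , B₂D₂∈xs , B₁⊆B₂ ← blocks-refine xs⊑ws B₁D₁∈ws
        with i , i∈B₀ ← All.lookup nonempty B₀D₀∈ys
        with refl ← same-block disjoint B₂D₂∈xs B'D'∈xs (B₁⊆B₂ (B₀⊆B₁ i∈B₀)) (B₀⊆B' i∈B₀)
        = proj₂ (images-compatible xs⊑ws B'D'∈xs j)
            (B₁ , D₁ , B₁D₁∈ws , B₁⊆B₂ ,
             proj₂ (images-compatible ws⊑ys B₁D₁∈ws j) (B₀ , D₀ , B₀D₀∈ys , B₀⊆B₁ , j∈D₀))

⊑-merge-head : ∀ {B B₁ B₂ C C' : Subset n} {T} → B₁ ⊆ B → B₂ ⊆ B → Nonempty B₁ → Nonempty B₂ →
               BlocksNonempty T → BlocksDisjoint ((B , C ∪ C') ∷ T) →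
               ((B , C ∪ C') ∷ T) ⊑ ((B₁ , C) ∷ (B₂ , C') ∷ T)
⊑-merge-head {B = B} {B₁} {B₂} {C} {C'} {T} B₁⊆B B₂⊆B (i₁ , i₁∈B₁) (i₂ , i₂∈B₂) nonempty
             (B-disjoint ∷ T-disjoint) = mk⊑ refine compatible
  where
  refine : BlocksRefine _ _
  refine (here refl)         = B , C ∪ C' , here refl , B₁⊆B
  refine (there (here refl)) = B , C ∪ C' , here refl , B₂⊆B
  refine {B'} {D'} (there (there B'D'∈T)) = B' , D' , there B'D'∈T , id
  compatible : ImagesCompatible _ _
  compatible (here refl) j = to , from
    where
    to : j ∈ₛ C ∪ C' → ImageBelow ((B₁ , C) ∷ (B₂ , C') ∷ T) B j
    to j∈C∪C' with x∈p∪q⁻ C C' j∈C∪C'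
    ... | inj₁ j∈C  = B₁ , C , here refl , B₁⊆B , j∈C
    ... | inj₂ j∈C' = B₂ , C' , there (here refl) , B₂⊆B , j∈C'
    from : ImageBelow ((B₁ , C) ∷ (B₂ , C') ∷ T) B j → j ∈ₛ C ∪ C'
    from (_ , _ , here refl , _ , j∈C)          = x∈p∪q⁺ (inj₁ j∈C)
    from (_ , _ , there (here refl) , _ , j∈C') = x∈p∪q⁺ (inj₂ j∈C')
    from (_ , _ , there (there B''D''∈T) , B''⊆B , _) =
      let i , i∈B'' = All.lookup nonempty B''D''∈T
      in ⊥-elim (All.lookup B-disjoint B''D''∈T (B''⊆B i∈B'') i∈B'')
  compatible {B'} {D'} (there B'D'∈T) j = to , from
    where
    to : j ∈ₛ D' → ImageBelow ((B₁ , C) ∷ (B₂ , C') ∷ T) B' j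
    to j∈D' = B' , D' , there (there B'D'∈T) , id , j∈D'
    from : ImageBelow ((B₁ , C) ∷ (B₂ , C') ∷ T) B' j → j ∈ₛ D'
    from (_ , _ , here refl , B₁⊆B' , _) =
      ⊥-elim (All.lookup B-disjoint B'D'∈T (B₁⊆B i₁∈B₁) (B₁⊆B' i₁∈B₁))
    from (_ , _ , there (here refl) , B₂⊆B' , _) =
      ⊥-elim (All.lookup B-disjoint B'D'∈T (B₂⊆B i₂∈B₂) (B₂⊆B' i₂∈B₂))
    from (_ , _ , there (there B''D''∈T) , B''⊆B' , j∈D'')
      with i , i∈B'' ← All.lookup nonempty B''D''∈T
      with refl ← same-block T-disjoint B''D''∈T B'D'∈T i∈B'' (B''⊆B' i∈B'')
      = j∈D''

⊑-cons : ∀ {B C : Subset n} {X Y} → Nonempty B → BlocksNonempty Y →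
         All (Disjoint B ∘ proj₁) X → All (Disjoint B ∘ proj₁) Y →
         X ⊑ Y → ((B , C) ∷ X) ⊑ ((B , C) ∷ Y)
⊑-cons {B = B} {C} {X} {Y} (i , i∈B) nonempty X-disjoint Y-disjoint X⊑Y = mk⊑ refine compatible
  where
  refine : BlocksRefine _ _
  refine (here refl) = B , C , here refl , id
  refine (there BD∈Y) = let B' , D' , B'D'∈X , B⊆B' = blocks-refine X⊑Y BD∈Y
                        in B' , D' , there B'D'∈X , B⊆B'
  compatible : ImagesCompatible _ _
  compatible (here refl) j = (λ j∈C → B , C , here refl , id , j∈C) , from
    where
    from : ImageBelow ((B , C) ∷ Y) B j → j ∈ₛ C
    from (_ , _ , here refl , _ , j∈C) = j∈C
    from (_ , _ , there B'D'∈Y , B'⊆B , _) =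
      let i' , i'∈B' = All.lookup nonempty B'D'∈Y
      in ⊥-elim (All.lookup Y-disjoint B'D'∈Y (B'⊆B i'∈B') i'∈B')
  compatible {B'} {D'} (there B'D'∈X) j = to , from
    where
    to : j ∈ₛ D' → ImageBelow ((B , C) ∷ Y) B' j
    to j∈D' = let B₀ , D₀ , B₀D₀∈Y , B₀⊆B' , j∈D₀ = proj₁ (images-compatible X⊑Y B'D'∈X j) j∈D'
              in B₀ , D₀ , there B₀D₀∈Y , B₀⊆B' , j∈D₀
    from : ImageBelow ((B , C) ∷ Y) B' j → j ∈ₛ D'
    from (_ , _ , here refl , B⊆B' , _) = ⊥-elim (All.lookup X-disjoint B'D'∈X i∈B (B⊆B' i∈B))
    from (B₀ , D₀ , there B₀D₀∈Y , B₀⊆B' , j∈D₀) =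
      proj₂ (images-compatible X⊑Y B'D'∈X j) (B₀ , D₀ , B₀D₀∈Y , B₀⊆B' , j∈D₀)

⊑-tail : ∀ {B C B' C' : Subset n} {X Y} → Nonempty B' → BlocksNonempty Y →
         All (Disjoint B' ∘ proj₁) X → All (Disjoint B ∘ proj₁) Y →
         ((B , C) ∷ X) ⊑ ((B' , C') ∷ Y) → X ⊑ Y
⊑-tail {B = B} {C} {B'} {C'} {X} {Y} (i , i∈B') nonempty X-disjoint Y-disjoint ⊑∷ =
  mk⊑ refine compatible
  where
  refine : BlocksRefine X Y
  refine B₀D₀∈Y with blocks-refine ⊑∷ (there B₀D₀∈Y)
  ... | _ , _ , here refl , B₀⊆B =
    let i₀ , i₀∈B₀ = All.lookup nonempty B₀D₀∈Y
    in ⊥-elim (All.lookup Y-disjoint B₀D₀∈Y (B₀⊆B i₀∈B₀) i₀∈B₀)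
  ... | B₁ , D₁ , there B₁D₁∈X , B₀⊆B₁ = B₁ , D₁ , B₁D₁∈X , B₀⊆B₁
  compatible : ImagesCompatible X Y
  compatible {B₁} {D₁} B₁D₁∈X j = to , from
    where
    to : j ∈ₛ D₁ → ImageBelow Y B₁ j
    to j∈D₁ with proj₁ (images-compatible ⊑∷ (there B₁D₁∈X) j) j∈D₁
    ... | _ , _ , here refl , B'⊆B₁ , _ = ⊥-elim (All.lookup X-disjoint B₁D₁∈X i∈B' (B'⊆B₁ i∈B'))
    ... | B₀ , D₀ , there B₀D₀∈Y , B₀⊆B₁ , j∈D₀ = B₀ , D₀ , B₀D₀∈Y , B₀⊆B₁ , j∈D₀
    from : ImageBelow Y B₁ j → j ∈ₛ D₁
    from (B₀ , D₀ , B₀D₀∈Y , B₀⊆B₁ , j∈D₀) =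
      proj₂ (images-compatible ⊑∷ (there B₁D₁∈X) j) (B₀ , D₀ , there B₀D₀∈Y , B₀⊆B₁ , j∈D₀)

⊑-merge-fine : ∀ {B B₁ B₂ C₁ C₂ Bₓ Cₓ : Subset n} {X T} → BlocksDisjoint X → (Bₓ , Cₓ) ∈ X →
               B ⊆ Bₓ → B₁ ⊆ B → B₂ ⊆ B → Nonempty B₁ → Nonempty B₂ →
               X ⊑ ((B₁ , C₁) ∷ (B₂ , C₂) ∷ T) → X ⊑ ((B , C₁ ∪ C₂) ∷ T)
⊑-merge-fine {B = B} {B₁} {B₂} {C₁} {C₂} {Bₓ} {Cₓ} {X} {T}
             disjoint BₓCₓ∈X B⊆Bₓ B₁⊆B B₂⊆B B₁-nonempty B₂-nonempty X⊑ = mk⊑ refine compatible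
  where
  refine : BlocksRefine X ((B , C₁ ∪ C₂) ∷ T)
  refine (here refl)  = Bₓ , Cₓ , BₓCₓ∈X , B⊆Bₓ
  refine (there BD∈T) = blocks-refine X⊑ (there (there BD∈T))
  compatible : ImagesCompatible X ((B , C₁ ∪ C₂) ∷ T)
  compatible {B'} {D'} B'D'∈X j = to , from
    where
    part⇒whole : ∀ {Bₖ} → Bₖ ⊆ B → Nonempty Bₖ → Bₖ ⊆ B' → B ⊆ B'
    part⇒whole Bₖ⊆B (i , i∈Bₖ) Bₖ⊆B'
      with refl ← same-block disjoint BₓCₓ∈X B'D'∈X (B⊆Bₓ (Bₖ⊆B i∈Bₖ)) (Bₖ⊆B' i∈Bₖ) = B⊆Bₓ
    to : j ∈ₛ D' → ImageBelow ((B , C₁ ∪ C₂) ∷ T) B' j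
    to j∈D' with proj₁ (images-compatible X⊑ B'D'∈X j) j∈D'
    ... | _ , _ , here refl , B₁⊆B' , j∈C₁ =
      B , C₁ ∪ C₂ , here refl , part⇒whole B₁⊆B B₁-nonempty B₁⊆B' , x∈p∪q⁺ (inj₁ j∈C₁)
    ... | _ , _ , there (here refl) , B₂⊆B' , j∈C₂ =
      B , C₁ ∪ C₂ , here refl , part⇒whole B₂⊆B B₂-nonempty B₂⊆B' , x∈p∪q⁺ (inj₂ j∈C₂)
    ... | B₀ , D₀ , there (there B₀D₀∈T) , B₀⊆B' , j∈D₀ = B₀ , D₀ , there B₀D₀∈T , B₀⊆B' , j∈D₀
    from : ImageBelow ((B , C₁ ∪ C₂) ∷ T) B' j → j ∈ₛ D'
    from (_ , _ , here refl , B⊆B' , j∈C₁∪C₂) with x∈p∪q⁻ C₁ C₂ j∈C₁∪C₂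
    ... | inj₁ j∈C₁ = proj₂ (images-compatible X⊑ B'D'∈X j) (B₁ , C₁ , here refl , B⊆B' ∘ B₁⊆B , j∈C₁)
    ... | inj₂ j∈C₂ = proj₂ (images-compatible X⊑ B'D'∈X j)
                              (B₂ , C₂ , there (here refl) , B⊆B' ∘ B₂⊆B , j∈C₂)
    from (B₀ , D₀ , there B₀D₀∈T , B₀⊆B' , j∈D₀) =
      proj₂ (images-compatible X⊑ B'D'∈X j) (B₀ , D₀ , there (there B₀D₀∈T) , B₀⊆B' , j∈D₀)

data Fills {n : ℕ} (s : ℕ) : List (Subset n) → Set where
  end   : s ≡ n → Fills s []
  block : ∀ {D ds} → Nonempty D → All (Disjoint D) ds → Fills (s + ∣ D ∣) ds → Fills s (D ∷ ds)

layout : ℕ → List (Subset n) → List (Pair n)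
layout s []       = []
layout s (D ∷ ds) = (interval s ∣ D ∣ , D) ∷ layout (s + ∣ D ∣) ds

Fills⇒≤ : ∀ {s} {ds : List (Subset n)} → Fills s ds → s ≤ n
Fills⇒≤ (end refl)          = ≤-refl
Fills⇒≤ {s = s} (block {D} _ _ fills) = ≤-trans (m≤m+n s ∣ D ∣) (Fills⇒≤ fills)

Fills-tail : ∀ {s D} {ds : List (Subset n)} → Fills s (D ∷ ds) → Fills (s + ∣ D ∣) ds
Fills-tail (block _ _ fills) = fills

Fills-head-size : ∀ {s D} {ds : List (Subset n)} → Fills s (D ∷ ds) → 1 ≤ ∣ D ∣ × s + ∣ D ∣ ≤ n
Fills-head-size (block D-nonempty _ fills) = Nonempty⇒∣p∣≥1 D-nonempty , Fills⇒≤ fills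

Fills-head-start : ∀ {s D} {ds : List (Subset n)} → Fills s (D ∷ ds) →
                   Σ (Fin n) λ e → toℕ e ≡ s × e ∈ₛ interval s ∣ D ∣
Fills-head-start fills = let 1≤a , s+a≤n = Fills-head-size fills in start∈interval 1≤a s+a≤n

Fills-head-nonempty : ∀ {s D} {ds : List (Subset n)} → Fills s (D ∷ ds) → Nonempty (interval {n} s ∣ D ∣)
Fills-head-nonempty fills = let e , _ , e∈I = Fills-head-start fills in e , e∈I

layout-above : ∀ {s} {ds : List (Subset n)} {B D i} → (B , D) ∈ layout s ds → i ∈ₛ B → s ≤ toℕ i
layout-above {s = s} {D ∷ ds} {i = i} (here refl) i∈B = proj₁ (∈-interval⁻ s ∣ D ∣ i i∈B)
layout-above {s = s} {D ∷ ds} (there BD∈) i∈B = ≤-trans (m≤m+n s ∣ D ∣) (layout-above BD∈ i∈B)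

layout-disjoint-from : ∀ {t a s} {ds : List (Subset n)} → t + a ≤ s →
                       All (Disjoint (interval t a) ∘ proj₁) (layout s ds)
layout-disjoint-from {t = t} {a} t+a≤s = All.tabulate λ {(B , D)} BD∈ {i} i∈I i∈B →
  <⇒≱ (proj₂ (∈-interval⁻ t a i i∈I)) (≤-trans t+a≤s (layout-above BD∈ i∈B))

layout-blocks-disjoint : ∀ s (ds : List (Subset n)) → BlocksDisjoint (layout s ds)
layout-blocks-disjoint s []       = []
layout-blocks-disjoint s (D ∷ ds) = layout-disjoint-from ≤-refl ∷ layout-blocks-disjoint (s + ∣ D ∣) ds

layout-blocks-nonempty : ∀ {s} {ds : List (Subset n)} → Fills s ds → BlocksNonempty (layout s ds)
layout-blocks-nonempty (end _)              = []
layout-blocks-nonempty fills@(block _ _ fills′) = Fills-head-nonempty fills ∷ layout-blocks-nonempty fills′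

map-proj₂-layout : ∀ s (ds : List (Subset n)) → map proj₂ (layout s ds) ≡ ds
map-proj₂-layout s []       = refl
map-proj₂-layout s (D ∷ ds) = cong (D ∷_) (map-proj₂-layout (s + ∣ D ∣) ds)

layout-sizes : ∀ {s} {ds : List (Subset n)} → Fills s ds → ∀ {B D} → (B , D) ∈ layout s ds → ∣ B ∣ ≡ ∣ D ∣
layout-sizes {s = s} (block {D} _ _ fills) (here refl) = ∣interval∣ s ∣ D ∣ (Fills⇒≤ fills)
layout-sizes (block _ _ fills) (there BD∈) = layout-sizes fills BD∈

layout-covers : ∀ {s} {ds : List (Subset n)} → Fills s ds →
                ∀ i → s ≤ toℕ i → Any ((i ∈ₛ_) ∘ proj₁) (layout s ds)
layout-covers (end refl) i n≤i = ⊥-elim (<⇒≱ (toℕ<n i) n≤i)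
layout-covers {s = s} (block {D} _ _ fills) i s≤i with toℕ i <? s + ∣ D ∣
... | yes i<s+a = here (∈-interval⁺ s ∣ D ∣ i s≤i i<s+a)
... | no  i≮s+a = there (layout-covers fills i (≮⇒≥ i≮s+a))

merged-offset : ∀ s {C C' : Subset n} → Disjoint C C' → s + ∣ C ∪ C' ∣ ≡ s + ∣ C ∣ + ∣ C' ∣
merged-offset s {C} {C'} d = trans (cong (s +_) (∣p∪q∣≡∣p∣+∣q∣ C C' d)) (sym (+-assoc s ∣ C ∣ ∣ C' ∣))

All-Disjoint-∪ : ∀ {C C' : Subset n} {ds} → All (Disjoint C) ds → All (Disjoint C') ds →
                 All (Disjoint (C ∪ C')) ds
All-Disjoint-∪ []             []               = []
All-Disjoint-∪ (C#D ∷ C#ds) (C'#D ∷ C'#ds) = Disjoint-∪ C#D C'#D ∷ All-Disjoint-∪ C#ds C'#ds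

All-Disjoint-merge : ∀ {D : Subset n} {ds' ds} → Merge ds' ds → All (Disjoint D) ds' → All (Disjoint D) ds
All-Disjoint-merge (here C C' cs) (D#C ∷ D#C' ∷ D#cs) =
  Disjoint-sym (Disjoint-∪ (Disjoint-sym D#C) (Disjoint-sym D#C')) ∷ D#cs
All-Disjoint-merge (there C merge) (D#C ∷ D#cs) = D#C ∷ All-Disjoint-merge merge D#cs

Fills-merge : ∀ {s} {ds' ds : List (Subset n)} → Merge ds' ds → Fills s ds' → Fills s ds
Fills-merge {s = s} (here C C' cs) (block C-nonempty (C#C' ∷ C#cs) (block _ C'#cs fills)) =
  block (proj₁ C-nonempty , x∈p∪q⁺ (inj₁ (proj₂ C-nonempty)))
        (All-Disjoint-∪ C#cs C'#cs)
        (subst (λ t → Fills t cs) (sym (merged-offset s C#C')) fills)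
Fills-merge (there C merge) (block C-nonempty C#ds fills) =
  block C-nonempty (All-Disjoint-merge merge C#ds) (Fills-merge merge fills)

layout-merge-⊑ : ∀ {s} {ds' ds : List (Subset n)} → Merge ds' ds → Fills s ds' → layout s ds ⊑ layout s ds'
layout-merge-⊑ {s = s} (here C C' cs) fills@(block _ (C#C' ∷ _) fills′@(block _ _ fills″))
  rewrite ∣p∪q∣≡∣p∣+∣q∣ C C' C#C' | sym (+-assoc s ∣ C ∣ ∣ C' ∣) =
  ⊑-merge-head (interval-⊆ˡ s ∣ C ∣ ∣ C' ∣) (interval-⊆ʳ s ∣ C ∣ ∣ C' ∣)
               (Fills-head-nonempty fills) (Fills-head-nonempty fills′) (layout-blocks-nonempty fills″)
               (layout-disjoint-from (≤-reflexive (sym (+-assoc s ∣ C ∣ ∣ C' ∣)))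
                ∷ layout-blocks-disjoint _ cs)
layout-merge-⊑ (there C merge) fills@(block _ _ fills′) =
  ⊑-cons (Fills-head-nonempty fills) (layout-blocks-nonempty fills′)
         (layout-disjoint-from ≤-refl) (layout-disjoint-from ≤-refl) (layout-merge-⊑ merge fills′)

layout-star-⊑ : ∀ {s} {ds' ds : List (Subset n)} → Star Merge ds' ds → Fills s ds' →
                layout s ds ⊑ layout s ds'
layout-star-⊑ {s = s} {ds'} ε fills = ⊑-refl (layout-blocks-disjoint s ds') (layout-blocks-nonempty fills)
layout-star-⊑ {s = s} {ds = ds} (merge ◅ merges) fills =
  ⊑-trans (layout-blocks-disjoint s ds) (layout-blocks-nonempty fills)
          (layout-star-⊑ merges (Fills-merge merge fills)) (layout-merge-⊑ merge fills)

Fills-[]-∷ : ∀ {s D} {ds : List (Subset n)} → Fills {n} s [] → Fills s (D ∷ ds) → Empty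
Fills-[]-∷ {s = s} (end refl) fills =
  let 1≤a , s+a≤n = Fills-head-size fills in <⇒≱ (m<m+n s 1≤a) s+a≤n

module _ {s} {C : Subset n} {cs ys} (coarse⊑ : layout s (C ∷ cs) ⊑ ys) where

  ⊆-first-block : ∀ {B D i} → (B , D) ∈ ys → i ∈ₛ B → toℕ i < s + ∣ C ∣ → B ⊆ interval s ∣ C ∣
  ⊆-first-block BD∈ys i∈B i<s+a with blocks-refine coarse⊑ BD∈ys
  ... | _ , _ , here refl , B⊆I = B⊆I
  ... | _ , _ , there B'D'∈ , B⊆B' = ⊥-elim (<⇒≱ i<s+a (layout-above B'D'∈ (B⊆B' i∈B)))

interval-split-⊆ : ∀ {s a b} {B : Subset n} → interval s a ⊆ B → interval (s + a) b ⊆ B →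
                   interval s (a + b) ⊆ B
interval-split-⊆ {s = s} {a} {b} I₁⊆B I₂⊆B {i} i∈I with ∈-interval⁻ s (a + b) i i∈I | toℕ i <? s + a
... | s≤i , _     | yes i<s+a = I₁⊆B (∈-interval⁺ s a i s≤i i<s+a)
... | _ , i<s+a+b | no  i≮s+a =
  I₂⊆B (∈-interval⁺ (s + a) b i (≮⇒≥ i≮s+a) (subst (toℕ i <_) (sym (+-assoc s a b)) i<s+a+b))

module _ {s} {C C' : Subset n} {cs cs'} (coarse : Fills s (C ∷ cs)) (fine : Fills s (C' ∷ cs'))
         (coarse⊑fine : layout s (C ∷ cs) ⊑ layout s (C' ∷ cs')) where

  first-block-⊆ : interval s ∣ C' ∣ ⊆ interval s ∣ C ∣
  first-block-⊆ = let e , e≡s , e∈I = Fills-head-start fine in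
    ⊆-first-block coarse⊑fine (here refl) e∈I
      (subst (_< s + ∣ C ∣) (sym e≡s) (m<m+n s (proj₁ (Fills-head-size coarse))))

  first-size-≤ : ∣ C' ∣ ≤ ∣ C ∣
  first-size-≤ = subst₂ _≤_ (∣interval∣ s ∣ C' ∣ (proj₂ (Fills-head-size fine)))
                            (∣interval∣ s ∣ C ∣ (proj₂ (Fills-head-size coarse)))
                            (p⊆q⇒∣p∣≤∣q∣ first-block-⊆)

  first-image-⊆ : C' ⊆ C
  first-image-⊆ {j} j∈C' =
    proj₂ (images-compatible coarse⊑fine (here refl) j) (_ , C' , here refl , first-block-⊆ , j∈C')

  first-image-⊇ : ∣ C' ∣ ≡ ∣ C ∣ → C ⊆ C'
  first-image-⊇ a'≡a {j} j∈C with proj₁ (images-compatible coarse⊑fine (here refl) j) j∈C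
  ... | _ , _ , here refl , _ , j∈C' = j∈C'
  ... | _ , _ , there BD∈ , B⊆I , _ =
    let i , i∈B = All.lookup (layout-blocks-nonempty (Fills-tail fine)) BD∈
    in ⊥-elim (<⇒≱ (proj₂ (∈-interval⁻ s ∣ C ∣ i (B⊆I i∈B)))
                   (subst (λ a → s + a ≤ toℕ i) a'≡a (layout-above BD∈ i∈B)))

⊑-merge-first : ∀ {s} {C C' C'' : Subset n} {cs cs''} → Fills s (C ∷ cs) → Fills s (C' ∷ C'' ∷ cs'') →
                ∣ C' ∣ < ∣ C ∣ → layout s (C ∷ cs) ⊑ layout s (C' ∷ C'' ∷ cs'') →
                layout s (C ∷ cs) ⊑ layout s ((C' ∪ C'') ∷ cs'')
⊑-merge-first {s = s} {C} {C'} {C''} {cs} coarse fine@(block _ (C'#C'' ∷ _) fine′) a'<a coarse⊑fine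
  rewrite ∣p∪q∣≡∣p∣+∣q∣ C' C'' C'#C'' | sym (+-assoc s ∣ C' ∣ ∣ C'' ∣) =
  ⊑-merge-fine (layout-blocks-disjoint s (C ∷ cs)) (here refl)
               (interval-split-⊆ (first-block-⊆ coarse fine coarse⊑fine) second-block-⊆)
               (interval-⊆ˡ s ∣ C' ∣ ∣ C'' ∣) (interval-⊆ʳ s ∣ C' ∣ ∣ C'' ∣)
               (Fills-head-nonempty fine) (Fills-head-nonempty fine′) coarse⊑fine
  where
  second-block-⊆ : interval (s + ∣ C' ∣) ∣ C'' ∣ ⊆ interval s ∣ C ∣
  second-block-⊆ = let e , e≡s+a' , e∈I = Fills-head-start fine′ in
    ⊆-first-block coarse⊑fine (there (here refl)) e∈I
      (subst (_< s + ∣ C ∣) (sym e≡s+a') (+-monoʳ-< s a'<a))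

layout-⊑⇒Star : ∀ k {s} {ds ds' : List (Subset n)} → length ds' ≡ k → Fills s ds → Fills s ds' →
                layout s ds ⊑ layout s ds' → Star Merge ds' ds
layout-⊑⇒Star _ {ds = []}    {[]}    _ _ _ _ = ε
layout-⊑⇒Star _ {ds = []}    {_ ∷ _} _ coarse fine _ = ⊥-elim (Fills-[]-∷ coarse fine)
layout-⊑⇒Star _ {ds = _ ∷ _} {[]}    _ coarse fine _ = ⊥-elim (Fills-[]-∷ fine coarse)
layout-⊑⇒Star (suc k) {s} {C ∷ cs} {C' ∷ cs'} len coarse fine coarse⊑fine
  with m≤n⇒m<n∨m≡n (first-size-≤ coarse fine coarse⊑fine)
... | inj₂ a'≡a
  with refl ← ⊆-antisym (first-image-⊆ coarse fine coarse⊑fine) (first-image-⊇ coarse fine coarse⊑fine a'≡a)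
  = gmap (C ∷_) (there C) (layout-⊑⇒Star k (suc-injective len) (Fills-tail coarse) (Fills-tail fine)
      (⊑-tail (Fills-head-nonempty fine) (layout-blocks-nonempty (Fills-tail fine))
              (layout-disjoint-from ≤-refl) (layout-disjoint-from ≤-refl) coarse⊑fine))
... | inj₁ a'<a with fine
...   | block _ _ (end s+a'≡n) =
  ⊥-elim (<⇒≱ (+-monoʳ-< s a'<a) (subst (s + ∣ C ∣ ≤_) (sym s+a'≡n) (proj₂ (Fills-head-size coarse))))
...   | fine@(block _ _ (block {C''} {cs''} _ _ _)) =
  here C' C'' cs'' ◅ layout-⊑⇒Star k (suc-injective len) coarse (Fills-merge (here C' C'' cs'') fine)
                                   (⊑-merge-first coarse fine a'<a coarse⊑fine)

Merge-length : ∀ {ds' ds : List (Subset n)} → Merge ds' ds → length ds' ≡ suc (length ds)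
Merge-length (here C C' cs)  = refl
Merge-length (there C merge) = cong suc (Merge-length merge)

Star-Merge-length : ∀ {ds' ds : List (Subset n)} → Star Merge ds' ds → length ds ≤ length ds'
Star-Merge-length ε                = ≤-refl
Star-Merge-length (merge ◅ merges) =
  ≤-trans (Star-Merge-length merges) (≤-trans (n≤1+n _) (≤-reflexive (sym (Merge-length merge))))

Star-Merge-antisym : ∀ {ds ds' : List (Subset n)} → Star Merge ds ds' → Star Merge ds' ds → ds ≡ ds'
Star-Merge-antisym ε                _       = refl
Star-Merge-antisym (merge ◅ merges) merges' = ⊥-elim (<⇒≱
  (≤-<-trans (Star-Merge-length merges) (≤-reflexive (sym (Merge-length merge))))
  (Star-Merge-length merges'))

record IsSetPartition′ (bs : List (Subset n)) : Set where
  field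
    nonempty : All Nonempty bs
    disjoint : AllPairs Disjoint bs
    covers   : ∀ i → Any (i ∈ₛ_) bs

All-lookup : ∀ {A : Set} {P : A → Set} {xs : List A} → (∀ k → P (lookup xs k)) → All P xs
All-lookup {P = P} Plookup = All.tabulate λ x∈xs → subst P (sym (lookup-index x∈xs)) (Plookup (index x∈xs))

unique⇒AllPairs-Disjoint : (bs : List (Subset n)) →
  (∀ i (k k' : Fin (length bs)) → i ∈ₛ lookup bs k → i ∈ₛ lookup bs k' → k ≡ k') → AllPairs Disjoint bs
unique⇒AllPairs-Disjoint []       unique = []
unique⇒AllPairs-Disjoint (b ∷ bs) unique =
  All-lookup (λ k i∈b i∈c → 0≢suc (unique _ zero (suc k) i∈b i∈c))
  ∷ unique⇒AllPairs-Disjoint bs (λ i k k' i∈ i∈' → Fin-suc-injective (unique i (suc k) (suc k') i∈ i∈'))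
  where
  0≢suc : ∀ {k : Fin (length bs)} → zero ≡ suc k → Empty
  0≢suc ()

AllPairs-Disjoint⇒unique : ∀ {bs : List (Subset n)} → AllPairs Disjoint bs →
  ∀ i (k k' : Fin (length bs)) → i ∈ₛ lookup bs k → i ∈ₛ lookup bs k' → k ≡ k'
AllPairs-Disjoint⇒unique (_ ∷ _)        i zero    zero     _   _   = refl
AllPairs-Disjoint⇒unique (b# ∷ _)       i zero    (suc k') i∈b i∈c = ⊥-elim (All.lookup b# (∈-lookup k') i∈b i∈c)
AllPairs-Disjoint⇒unique (b# ∷ _)       i (suc k) zero     i∈c i∈b = ⊥-elim (All.lookup b# (∈-lookup k) i∈b i∈c)
AllPairs-Disjoint⇒unique (_ ∷ disjoint) i (suc k) (suc k') i∈  i∈' =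
  cong suc (AllPairs-Disjoint⇒unique disjoint i k k' i∈ i∈')

IsSetPartition⇒IsSetPartition′ : {bs : List (Subset n)} → IsSetPartition bs → IsSetPartition′ bs
IsSetPartition⇒IsSetPartition′ {bs = bs} partition = record
  { nonempty = All-lookup (IsSetPartition.nonempty partition)
  ; disjoint = unique⇒AllPairs-Disjoint bs (IsSetPartition.unique partition)
  ; covers   = λ i → let k , i∈ = IsSetPartition.cover partition i in lose (∈-lookup k) i∈
  }

IsSetPartition′⇒IsSetPartition : {bs : List (Subset n)} → IsSetPartition′ bs → IsSetPartition bs
IsSetPartition′⇒IsSetPartition partition = record
  { nonempty = λ k → All.lookup (IsSetPartition′.nonempty partition) (∈-lookup k)
  ; cover    = λ i → let i∈ = IsSetPartition′.covers partition i in index i∈ , lookup-index i∈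
  ; unique   = AllPairs-Disjoint⇒unique (IsSetPartition′.disjoint partition)
  }

Disjoint-⋃ : ∀ {D : Subset n} {ds} → All (Disjoint D) ds → Disjoint D (⋃ ds)
Disjoint-⋃ {ds = []}     []             _   i∈⋃ = ∉⊥ i∈⋃
Disjoint-⋃ {ds = E ∷ ds} (D#E ∷ D#ds) i∈D i∈⋃ with x∈p∪q⁻ E (⋃ ds) i∈⋃
... | inj₁ i∈E = D#E i∈D i∈E
... | inj₂ i∈⋃ds = Disjoint-⋃ D#ds i∈D i∈⋃ds

∣⋃∣≡sum : ∀ {ds : List (Subset n)} → AllPairs Disjoint ds → ∣ ⋃ ds ∣ ≡ sum (map ∣_∣ ds)
∣⋃∣≡sum {n} {[]}     []                 = ∣⊥∣≡0 n
∣⋃∣≡sum {ds = D ∷ ds} (D#ds ∷ disjoint) =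
  trans (∣p∪q∣≡∣p∣+∣q∣ D (⋃ ds) (Disjoint-⋃ D#ds)) (cong (∣ D ∣ +_) (∣⋃∣≡sum disjoint))

∈-⋃⁻ : ∀ {ds} {i : Fin n} → i ∈ₛ ⋃ ds → Any (i ∈ₛ_) ds
∈-⋃⁻ {ds = []}     i∈⋃ = ⊥-elim (∉⊥ i∈⋃)
∈-⋃⁻ {ds = D ∷ ds} i∈⋃ with x∈p∪q⁻ D (⋃ ds) i∈⋃
... | inj₁ i∈D   = here i∈D
... | inj₂ i∈⋃ds = there (∈-⋃⁻ i∈⋃ds)

∈-⋃⁺ : ∀ {ds} {i : Fin n} → Any (i ∈ₛ_) ds → i ∈ₛ ⋃ ds
∈-⋃⁺ (here i∈D)  = x∈p∪q⁺ (inj₁ i∈D)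
∈-⋃⁺ (there i∈) = x∈p∪q⁺ (inj₂ (∈-⋃⁺ i∈))

Fills⇒sizes : ∀ {s} {ds : List (Subset n)} → Fills s ds →
              All Nonempty ds × AllPairs Disjoint ds × s + sum (map ∣_∣ ds) ≡ n
Fills⇒sizes {s = s} (end s≡n) = [] , [] , trans (+-identityʳ s) s≡n
Fills⇒sizes {s = s} (block {D} D-nonempty D#ds fills) =
  let nonempty , disjoint , s+a+Σ≡n = Fills⇒sizes fills
  in D-nonempty ∷ nonempty , D#ds ∷ disjoint , trans (sym (+-assoc s ∣ D ∣ _)) s+a+Σ≡n

sizes⇒Fills : ∀ {s} {ds : List (Subset n)} → All Nonempty ds → AllPairs Disjoint ds →
              s + sum (map ∣_∣ ds) ≡ n → Fills s ds
sizes⇒Fills {s = s} []                   []                s+0≡n = end (trans (sym (+-identityʳ s)) s+0≡n)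
sizes⇒Fills {s = s} {D ∷ _} (D-nonempty ∷ nonempty) (D#ds ∷ disjoint) s+Σ≡n =
  block D-nonempty D#ds (sizes⇒Fills nonempty disjoint (trans (+-assoc s ∣ D ∣ _) s+Σ≡n))

Fills⇒IsSetPartition′ : {ds : List (Subset n)} → Fills 0 ds → IsSetPartition′ ds
Fills⇒IsSetPartition′ {ds = ds} fills with nonempty , disjoint , Σ≡n ← Fills⇒sizes fills = record
  { nonempty = nonempty
  ; disjoint = disjoint
  ; covers   = λ i → ∈-⋃⁻ (subst (i ∈ₛ_) (sym ⋃≡⊤) ∈⊤)
  }
  where
  ⋃≡⊤ : ⋃ ds ≡ ⊤
  ⋃≡⊤ = ∣p∣≡n⇒p≡⊤ (trans (∣⋃∣≡sum disjoint) Σ≡n)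

IsSetPartition′⇒Fills : {ds : List (Subset n)} → IsSetPartition′ ds → Fills 0 ds
IsSetPartition′⇒Fills {n} {ds} partition = sizes⇒Fills nonempty disjoint
  (trans (sym (∣⋃∣≡sum disjoint)) (trans (cong ∣_∣ ⋃≡⊤) (∣⊤∣≡n n)))
  where
  open IsSetPartition′ partition
  ⋃≡⊤ : ⋃ ds ≡ ⊤
  ⋃≡⊤ = ⊆-antisym ⊆⊤ (λ {i} _ → ∈-⋃⁺ (covers i))

All-Convex⇒IsInterval : {bs : List (Subset n)} → All Convex bs → IsInterval bs
All-Convex⇒IsInterval convex k = All.lookup convex (∈-lookup k)

IsInterval⇒IsNoncrossing : {bs : List (Subset n)} → AllPairs Disjoint bs → IsInterval bs → IsNoncrossing bs
IsInterval⇒IsNoncrossing disjoint intervals k k' k≢k' a b c d a<b b<c c<d a∈ c∈ b∈' d∈' =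
  k≢k' (AllPairs-Disjoint⇒unique disjoint b k k' (intervals k a b c a∈ c∈ (<⇒≤ a<b) (<⇒≤ b<c)) b∈')

layout-convex : ∀ s (ds : List (Subset n)) → All (Convex ∘ proj₁) (layout s ds)
layout-convex s []       = []
layout-convex s (D ∷ ds) = interval-convex s ∣ D ∣ ∷ layout-convex (s + ∣ D ∣) ds

layout-Q : OSP n → Q n
layout-Q (ds , partition) =
  (layout 0 ds , record
    { π-partition   = IsSetPartition′⇒IsSetPartition π-partition
    ; π-noncrossing = IsInterval⇒IsNoncrossing (IsSetPartition′.disjoint π-partition) intervals
    ; ρ-partition   = subst IsSetPartition (sym (map-proj₂-layout 0 ds)) partition
    ; sizes         = layout-sizes fills
    }) , intervals
  where
  fills : Fills 0 ds
  fills = IsSetPartition′⇒Fills (IsSetPartition⇒IsSetPartition′ partition)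
  π-partition : IsSetPartition′ (map proj₁ (layout 0 ds))
  π-partition = record
    { nonempty = All.map⁺ (layout-blocks-nonempty fills)
    ; disjoint = AllPairs.map⁺ (layout-blocks-disjoint 0 ds)
    ; covers   = λ i → Any.map⁺ (layout-covers fills i z≤n)
    }
  intervals : IsInterval (map proj₁ (layout 0 ds))
  intervals = All-Convex⇒IsInterval (All.map⁺ (layout-convex 0 ds))

pick : ∀ {A : Set} {P : A → Set} {xs : List A} → Any P xs → Σ A λ x → P x × Σ (List A) λ r → x ∷ r ↭ xs
pick any with x , x∈xs , px ← find any with ys , zs , refl ← ∈-∃++ x∈xs =
  x , px , ys ++ zs , ↭-sym (shift x ys zs)

DisjointPairs : Pair n → Pair n → Set
DisjointPairs p q = Disjoint (proj₁ p) (proj₁ q) × Disjoint (proj₂ p) (proj₂ q)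

DisjointPairs-sym : {p q : Pair n} → DisjointPairs p q → DisjointPairs q p
DisjointPairs-sym (B#B' , D#D') = Disjoint-sym B#B' , Disjoint-sym D#D'

record Block (s : ℕ) (p : Pair n) : Set where
  field
    block-nonempty : Nonempty (proj₁ p)
    image-nonempty : Nonempty (proj₂ p)
    convex         : Convex (proj₁ p)
    same-size      : ∣ proj₁ p ∣ ≡ ∣ proj₂ p ∣
    above          : ∀ {i} → i ∈ₛ proj₁ p → s ≤ toℕ i

-- The blocks of an element of Q_n that are still to be listed once the positions
-- below s have been used up.
record Remaining (s : ℕ) (xs : List (Pair n)) : Set where
  field
    blocks   : All (Block s) xs
    disjoint : AllPairs DisjointPairs xs
    covers   : ∀ i → s ≤ toℕ i → Any ((i ∈ₛ_) ∘ proj₁) xs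
    bounded  : s ≤ n
open Remaining

Remaining-resp-↭ : ∀ {s} {xs ys : List (Pair n)} → xs ↭ ys → Remaining s xs → Remaining s ys
Remaining-resp-↭ {n} σ remaining = record
  { blocks   = All-resp-↭ σ (blocks remaining)
  ; disjoint = Permutationₛ.AllPairs-resp-↭ (setoid (Pair n)) DisjointPairs-sym (resp₂ DisjointPairs)
                 (↭⇒↭ₛ σ) (disjoint remaining)
  ; covers   = λ i s≤i → Any-resp-↭ σ (covers remaining i s≤i)
  ; bounded  = bounded remaining
  }

Remaining-step : ∀ {s} {B D : Subset n} {r} {e : Fin n} → toℕ e ≡ s → e ∈ₛ B →
                 Remaining s ((B , D) ∷ r) →
                 B ≡ interval s ∣ D ∣ × Nonempty D × All (Disjoint D ∘ proj₂) r × Remaining (s + ∣ D ∣) r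
Remaining-step {n} {s} {B} {D} {r} e≡s e∈B remaining
  with B-block ∷ r-blocks ← blocks remaining | B#r ∷ r-disjoint ← disjoint remaining =
  B≡I , Block.image-nonempty B-block , All.map proj₂ B#r , record
    { blocks   = All.map shift-above (All.zip (r-blocks , B#r))
    ; disjoint = r-disjoint
    ; covers   = covers′
    ; bounded  = subst (λ a → s + a ≤ n) (Block.same-size B-block) (proj₁ B-interval)
    }
  where
  a : ℕ
  a = ∣ D ∣
  B-interval : s + ∣ B ∣ ≤ n × B ≡ interval s ∣ B ∣
  B-interval = convex-interval (Block.convex B-block) e∈B e≡s (Block.above B-block)
  B≡I : B ≡ interval s a
  B≡I = trans (proj₂ B-interval) (cong (interval s) (Block.same-size B-block))
  shift-above : ∀ {p} → Block s p × DisjointPairs (B , D) p → Block (s + a) p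
  shift-above (block′ , B#B' , _) = record
    { block-nonempty = Block.block-nonempty block′
    ; image-nonempty = Block.image-nonempty block′
    ; convex         = Block.convex block′
    ; same-size      = Block.same-size block′
    ; above          = λ {i} i∈B' → ≮⇒≥ λ i<s+a →
        B#B' (subst (i ∈ₛ_) (sym B≡I) (∈-interval⁺ s a i (Block.above block′ i∈B') i<s+a)) i∈B'
    }
  covers′ : ∀ i → s + a ≤ toℕ i → Any ((i ∈ₛ_) ∘ proj₁) r
  covers′ i s+a≤i with covers remaining i (≤-trans (m≤m+n s a) s+a≤i)
  ... | here i∈B = ⊥-elim (<⇒≱ (proj₂ (∈-interval⁻ s a i (subst (i ∈ₛ_) B≡I i∈B))) s+a≤i)
  ... | there i∈r = i∈r

sort-from : ∀ k {s} (xs : List (Pair n)) → length xs ≡ k → Remaining s xs →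
            Σ (List (Subset n)) λ ds → Fills s ds × layout s ds ↭ xs
sort-from {n} k {s} xs len remaining with s <? n
sort-from k [] _ remaining | no s≮n = [] , end (≤-antisym (bounded remaining) (≮⇒≥ s≮n)) , refl
sort-from k (_ ∷ _) _ remaining | no s≮n with B-block ∷ _ ← blocks remaining =
  let i , i∈B = Block.block-nonempty B-block
  in ⊥-elim (s≮n (≤-<-trans (Block.above B-block i∈B) (toℕ<n i)))
sort-from zero [] refl remaining | yes s<n =
  ⊥-elim (¬Any[] (covers remaining (fromℕ< s<n) (≤-reflexive (sym (toℕ-fromℕ< s<n)))))
sort-from (suc k) {s} xs len remaining | yes s<n
  with (B , D) , e∈B , r , σ ← pick (covers remaining (fromℕ< s<n) (≤-reflexive (sym (toℕ-fromℕ< s<n))))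
  with refl , D-nonempty , D#r , remaining′
         ← Remaining-step (toℕ-fromℕ< s<n) e∈B (Remaining-resp-↭ (↭-sym σ) remaining)
  with ds , fills , τ ← sort-from k r (suc-injective (trans (↭-length σ) len)) remaining′
  = D ∷ ds
  , block D-nonempty
          (subst (All (Disjoint D)) (map-proj₂-layout _ ds) (All.map⁺ (All-resp-↭ (↭-sym τ) D#r)))
          fills
  , ↭-trans (prep _ τ) σ

Q⇒Remaining : (x : Q n) → Remaining 0 (proj₁ (proj₁ x))
Q⇒Remaining ((xs , pi2) , intervals) = record
  { blocks   = All.tabulate λ p∈xs → record
      { block-nonempty = All.lookup (All.map⁻ (IsSetPartition′.nonempty π-partition)) p∈xs
      ; image-nonempty = All.lookup (All.map⁻ (IsSetPartition′.nonempty ρ-partition)) p∈xs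
      ; convex         = All.lookup (All.map⁻ (All-lookup {P = Convex} intervals)) p∈xs
      ; same-size      = IsPi2.sizes pi2 p∈xs
      ; above          = λ _ → z≤n
      }
  ; disjoint = AllPairs.zip (AllPairs.map⁻ (IsSetPartition′.disjoint π-partition) ,
                             AllPairs.map⁻ (IsSetPartition′.disjoint ρ-partition))
  ; covers   = λ i _ → Any.map⁻ (IsSetPartition′.covers π-partition i)
  ; bounded  = z≤n
  }
  where
  π-partition : IsSetPartition′ (map proj₁ xs)
  π-partition = IsSetPartition⇒IsSetPartition′ (IsPi2.π-partition pi2)
  ρ-partition : IsSetPartition′ (map proj₂ xs)
  ρ-partition = IsSetPartition⇒IsSetPartition′ (IsPi2.ρ-partition pi2)

sort : (x : Q n) → Σ (List (Subset n)) λ ds → Fills 0 ds × layout 0 ds ↭ proj₁ (proj₁ x)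
sort x = sort-from _ (proj₁ (proj₁ x)) refl (Q⇒Remaining x)

to-OSP : Q n → OSP n
to-OSP x = let ds , fills , _ = sort x in ds , IsSetPartition′⇒IsSetPartition (Fills⇒IsSetPartition′ fills)

layout-↭⇒≡ : ∀ {s} {ds es : List (Subset n)} → Fills s ds → Fills s es → layout s ds ↭ layout s es → ds ≡ es
layout-↭⇒≡ {s = s} {ds} {es} ds-fills es-fills σ = Star-Merge-antisym
  (layout-⊑⇒Star _ refl es-fills ds-fills
    (⊑-resp-↭ σ refl (⊑-refl (layout-blocks-disjoint s ds) (layout-blocks-nonempty ds-fills))))
  (layout-⊑⇒Star _ refl ds-fills es-fills
    (⊑-resp-↭ (↭-sym σ) refl (⊑-refl (layout-blocks-disjoint s es) (layout-blocks-nonempty es-fills))))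

to-OSP-monotone : (x y : Q n) → x ≤Q y → to-OSP x ≤OSP to-OSP y
to-OSP-monotone x y x≤y =
  let _ , x-fills , σ = sort x ; _ , y-fills , τ = sort y
  in layout-⊑⇒Star _ refl x-fills y-fills (⊑-resp-↭ (↭-sym σ) (↭-sym τ) (≤Π²⇒⊑ x≤y))

to-OSP-reflects : (x y : Q n) → to-OSP x ≤OSP to-OSP y → x ≤Q y
to-OSP-reflects x y merges =
  let _ , _ , σ = sort x ; _ , y-fills , τ = sort y
  in ⊑⇒≤Π² (⊑-resp-↭ σ τ (layout-star-⊑ merges y-fills))

to-OSP-layout-Q : (z : OSP n) → proj₁ (to-OSP (layout-Q z)) ≡ proj₁ z
to-OSP-layout-Q (zs , partition) =
  let _ , fills , σ = sort (layout-Q (zs , partition))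
  in layout-↭⇒≡ fills (IsSetPartition′⇒Fills (IsSetPartition⇒IsSetPartition′ partition)) σ

proposition27 : (n : ℕ) →
    Σ (Q n → OSP n) λ f →
      ((x y : Q n) → (x ≤Q y → f x ≤OSP f y) × (f x ≤OSP f y → x ≤Q y))
      × ((z : OSP n) → Σ (Q n) λ x → proj₁ (f x) ≡ proj₁ z)
proposition27 n =
  to-OSP , (λ x y → to-OSP-monotone x y , to-OSP-reflects x y) , λ z → layout-Q z , to-OSP-layout-Q z
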